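{- Let $G$ be a multigraph (loops and parallel edges allowed) and $e$ an edge of $G$. Then $$P(\mathcal{H}_G,\lambda)=\lambda\,P(\mathcal{H}_{G-e},\lambda)-P(\mathcal{H}_{G/e},\lambda),$$ where $G-e$ is obtained by deleting $e$ and $G/e$ by contracting $e$ (identifying its two ends and deleting $e$; if $e$ is a loop, $G/e=G-e$).
   Context: A hypergraph $\mathcal{H}=(\mathcal{V},\mathcal{E})$ has a finite vertex set and a set of edges, each a subset of $\mathcal{V}$ of size at least 1. For positive integer $\lambda$, a weak proper $\lambda$-colouring is a map $\phi:\mathcal{V}\to\{1,\dots,\lambda\}$ with $|\{\phi(v):v\in e\}|>1$ for each edge $e$; $P(\mathcal{H},\lambda)$ is the polynomial counting them. For a multigraph $G=(V,E)$, $\mathcal{H}_G$ has vertex set $V\cup\{w_f:f\in E\}$ (new distinct vertices) and edge set $\{\{u_f,v_f,w_f\}:f\in E\}$, with $u_f,v_f$ the ends of $f$. -}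

module Defs where

open import Data.Nat using (ℕ; zero; suc; _+_; _<_)
open import Data.Nat.Properties using (_<?_)
open import Data.Fin using (Fin; zero; suc; punchIn; punchOut; _↑ˡ_; _↑ʳ_; _≟_)
open import Data.Product using (_×_; _,_; proj₁; proj₂)
open import Data.List using (List; []; _∷_; map; concatMap; length; filter; deduplicate)
open import Data.List.Relation.Unary.All using (All)
open import Data.List.Relation.Unary.All using (all?) renaming ()
open import Data.Empty using (⊥-elim)
open import Relation.Nullary using (Dec; yes; no)
open import Relation.Unary using (Decidable)
import Data.Vec.Functional as VF

-- Hypergraphs on the vertex set Fin N.  An edge is a (nonempty) list of
-- vertices, read as the set of its entries.

record Hypergraph : Set where
  field
    nVert : ℕ
    edges : List (List (Fin nVert))
open Hypergraph public

Proper : (H : Hypergraph) (k : ℕ) → (Fin (nVert H) → Fin k) → Set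
Proper H k φ = All (λ e → 1 < length (deduplicate _≟_ (map φ e))) (edges H)

proper? : (H : Hypergraph) (k : ℕ) → Decidable (Proper H k)
proper? H k φ = all? (λ e → 1 <? length (deduplicate _≟_ (map φ e))) (edges H)

allFns : (N k : ℕ) → List (Fin N → Fin k)
allFns zero    k = (λ ()) ∷ []
allFns (suc N) k = concatMap (λ c → map (λ f → c VF.∷ f) (allFns N k)) (allFin k)
  where open import Data.List using (allFin)

P : Hypergraph → ℕ → ℕ
P H k = length (filter (proper? H k) (allFns (nVert H) k))

-- Multigraphs: vertex set Fin nV, edge set Fin nE, each edge has two ends
-- (equal ends = loop; parallel edges allowed).

record Multigraph : Set where
  constructor mg
  field
    nV   : ℕ
    nE   : ℕ
    ends : Fin nE → Fin nV × Fin nV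
open Multigraph public

-- H_G: vertices Fin (nV + nE): v ↑ˡ nE for v ∈ V, nV ↑ʳ f for w_f;
-- edges {u_f, v_f, w_f} for each edge f.
H : Multigraph → Hypergraph
H (mg n m ends) = record
  { nVert = n + m
  ; edges = map (λ f → (proj₁ (ends f) ↑ˡ m) ∷ (proj₂ (ends f) ↑ˡ m) ∷ (n ↑ʳ f) ∷ [])
                (Data.List.allFin m)
  }
  where import Data.List

deleteAux : (n m : ℕ) → (Fin (suc m) → Fin n × Fin n) → Fin (suc m) → Multigraph
deleteAux n m ends e = mg n m (λ f → ends (punchIn e f))

delete : (G : Multigraph) → Fin (nE G) → Multigraph
delete (mg n zero    ends) ()
delete (mg n (suc m) ends) e = deleteAux n m ends e

-- Otherwise with ends
-- u ≠ v, vertex v is identified with u: the vertex set becomes Fin (n-1),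
-- x ↦ punchOut of x (x ≠ v) and v ↦ image of u; then e is deleted.
contractAux : (n m : ℕ) → (Fin (suc m) → Fin n × Fin n) → Fin (suc m) → Multigraph
contractAux n m ends e with proj₁ (ends e) ≟ proj₂ (ends e)
... | yes _ = deleteAux n m ends e
contractAux zero m ends e | no _ with proj₁ (ends e)
... | ()
contractAux (suc n) m ends e | no u≢v =
  mg n m (λ f → merge (proj₁ (ends (punchIn e f))) , merge (proj₂ (ends (punchIn e f))))
  where
  u = proj₁ (ends e)
  v = proj₂ (ends e)
  merge : Fin (suc n) → Fin n
  merge x with v ≟ x
  ... | yes _   = punchOut {i = v} {j = u} (λ eq → u≢v (Relation.Binary.PropositionalEquality.sym eq))
    where import Relation.Binary.PropositionalEquality
  ... | no v≢x = punchOut v≢x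

contract : (G : Multigraph) → Fin (nE G) → Multigraph
contract (mg n zero    ends) ()
contract (mg n (suc m) ends) e = contractAux n m ends e

module Submission where

-- Fix an edge e of G with ends u, v. A colouring φ of H_G is the same thing as a colour c
-- for the new vertex w_e together with a colouring ψ of H_{G-e}, and φ is proper iff ψ is
-- proper and the hyperedge {u, v, w_e} is not monochromatic, i.e. not (ψ u = c = ψ v).
-- Summing over c gives the deletion identity
--     P(H_G) + #{ψ proper for H_{G-e} : ψ u = ψ v} = λ · P(H_{G-e}).
-- The middle term is P(H_{G/e}): for a loop the condition ψ u = ψ v is vacuous and
-- G/e = G-e; otherwise ψ is determined by its restriction χ to the vertices other than v
-- and its colour at v, which is forced to be χ(u); the hyperedges of H_{G-e} under ψ then
-- carry exactly the colours of the hyperedges of H_{G/e} under χ.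

open import Defs
open import Data.Nat using (ℕ; _≤_)
open import Data.Fin using (Fin)
open import Data.Integer using (ℤ; +_; _*_; _-_)
open import Relation.Binary.PropositionalEquality using (_≡_)

open import Level using (0ℓ)
open import Function using (_∘_; _⇔_; mk⇔; Equivalence)
open import Data.Bool using (if_then_else_)
open import Data.Empty using (⊥-elim)
open import Data.Sum using ([_,_]′)
open import Data.Product using (Σ; _×_; _,_; proj₁; proj₂)
open import Data.Nat using (zero; suc; _+_; _<_; _∸_; s≤s; z≤n)
import Data.Nat as Nat
open import Data.Nat.Properties
  using (+-0-commutativeMonoid; +-commutativeSemigroup; m≤n+m; m+n∸n≡m)
open import Data.Integer using (_⊖_)
open import Data.Integer.Properties using (m-n≡m⊖n; ⊖-≥; pos-*)
open import Data.Fin using (zero; suc; punchIn; punchOut; _↑ˡ_; _↑ʳ_; _≟_)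
open import Data.Fin.Properties using (¬Fin0; punchInᵢ≢i; punchIn-punchOut; punchOut-cong)
import Data.Vec.Functional as VF
open import Data.List using (List; []; _∷_; _++_; map; length; filter; deduplicate; tabulate; concatMap)
open import Data.List.Properties using (filter-++; filter-≐; length-++)
open import Data.List.Relation.Unary.All.Properties using (map⁺; map⁻; tabulate⁺; tabulate⁻)
open import Relation.Nullary using (Dec; yes; no; ¬_; does; contradiction)
open import Relation.Nullary.Decidable using (_×-dec_; ¬?; toSum; dec-true; dec-false)
open import Relation.Unary using (Pred; Decidable)
open import Relation.Binary.PropositionalEquality using (refl; sym; trans; cong; cong₂; subst; _≢_; ≢-sym; module ≡-Reasoning)
open import Algebra.Properties.CommutativeMonoid.Sum +-0-commutativeMonoid
  using (sum-syntax; sum-cong-≗; sum-replicate-zero; sum-remove; ∑-distrib-+; ∑-comm)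
open import Algebra.Properties.CommutativeSemigroup +-commutativeSemigroup using (interchange)

open ≡-Reasoning
open Equivalence using (to; from)

count : {A : Set} {Q : Pred A 0ℓ} → Decidable Q → List A → ℕ
count Q? xs = length (filter Q? xs)

indicator : {A : Set} → Dec A → ℕ
indicator a? = if does a? then 1 else 0

count-∷ : {A : Set} {Q : Pred A 0ℓ} (Q? : Decidable Q) (x : A) (xs : List A) →
          count Q? (x ∷ xs) ≡ indicator (Q? x) + count Q? xs
count-∷ Q? x xs with Q? x
... | yes _ = refl
... | no _  = refl

count-⇔ : {A : Set} {Q R : Pred A 0ℓ} (Q? : Decidable Q) (R? : Decidable R) →
          (∀ x → Q x ⇔ R x) → ∀ xs → count Q? xs ≡ count R? xs
count-⇔ Q? R? Q⇔R xs =
  cong length (filter-≐ Q? R? ((λ {x} → to (Q⇔R x)) , (λ {x} → from (Q⇔R x))) xs)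

count-map : {A B : Set} {Q : Pred B 0ℓ} (Q? : Decidable Q) (g : A → B) (xs : List A) →
            count Q? (map g xs) ≡ count (λ x → Q? (g x)) xs
count-map Q? g []       = refl
count-map Q? g (x ∷ xs) with Q? (g x)
... | yes _ = cong suc (count-map Q? g xs)
... | no _  = count-map Q? g xs

count-concatMap : {A C : Set} {Q : Pred A 0ℓ} (Q? : Decidable Q) {k : ℕ}
                  (g : Fin k → C) (h : C → List A) →
                  count Q? (concatMap h (tabulate g)) ≡ ∑[ i < k ] count Q? (h (g i))
count-concatMap Q? {zero}  g h = refl
count-concatMap {A} Q? {suc k} g h = begin
  length (filter Q? (h (g zero) ++ rest))         ≡⟨ cong length (filter-++ Q? (h (g zero)) rest) ⟩
  length (filter Q? (h (g zero)) ++ filter Q? rest) ≡⟨ length-++ (filter Q? (h (g zero))) ⟩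
  count Q? (h (g zero)) + count Q? rest           ≡⟨ cong (_+_ (count Q? (h (g zero)))) (count-concatMap Q? (g ∘ suc) h) ⟩
  ∑[ i < suc k ] count Q? (h (g i))               ∎
  where
  rest : List A
  rest = concatMap h (tabulate (g ∘ suc))

count-split : {A : Set} {Q R : Pred A 0ℓ} (Q? : Decidable Q) (R? : Decidable R) (xs : List A) →
              count (λ x → Q? x ×-dec ¬? (R? x)) xs + count (λ x → Q? x ×-dec R? x) xs ≡ count Q? xs
count-split Q? R? []       = refl
count-split {Q = Q} {R} Q? R? (x ∷ xs) = begin
  count Q¬R? (x ∷ xs) + count QR? (x ∷ xs)
    ≡⟨ cong₂ _+_ (count-∷ Q¬R? x xs) (count-∷ QR? x xs) ⟩
  (indicator (Q¬R? x) + count Q¬R? xs) + (indicator (QR? x) + count QR? xs)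
    ≡⟨ interchange (indicator (Q¬R? x)) _ _ _ ⟩
  (indicator (Q¬R? x) + indicator (QR? x)) + (count Q¬R? xs + count QR? xs)
    ≡⟨ cong₂ _+_ (indicator-split (Q? x) (R? x)) (count-split Q? R? xs) ⟩
  indicator (Q? x) + count Q? xs
    ≡⟨ count-∷ Q? x xs ⟨
  count Q? (x ∷ xs) ∎
  where
  Q¬R? : Decidable (λ x → Q x × ¬ R x)
  Q¬R? x = Q? x ×-dec ¬? (R? x)
  QR? : Decidable (λ x → Q x × R x)
  QR? x = Q? x ×-dec R? x
  indicator-split : {B C : Set} (b? : Dec B) (c? : Dec C) →
                    indicator (b? ×-dec ¬? c?) + indicator (b? ×-dec c?) ≡ indicator b?
  indicator-split (yes _) (yes _) = refl
  indicator-split (yes _) (no _)  = refl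
  indicator-split (no _)  (yes _) = refl
  indicator-split (no _)  (no _)  = refl

sum-const : ∀ n x → ∑[ i < n ] x ≡ n Nat.* x
sum-const zero    x = refl
sum-const (suc n) x = cong (_+_ x) (sum-const n x)

sum-delta : ∀ {k} (a : Fin k) → ∑[ c < k ] indicator (a ≟ c) ≡ 1
sum-delta {suc k} a = begin
  ∑[ c < suc k ] t c                ≡⟨ sum-remove {i = a} t ⟩
  t a + ∑[ j < k ] t (punchIn a j)  ≡⟨ cong₂ _+_ (cong (if_then 1 else 0) (dec-true (a ≟ a) refl))
                                                  (trans (sum-cong-≗ off-a) (sum-replicate-zero k)) ⟩
  1                                 ∎
  where
  t : Fin (suc k) → ℕ
  t c = indicator (a ≟ c)
  off-a : ∀ j → t (punchIn a j) ≡ 0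
  off-a j = cong (if_then 1 else 0) (dec-false (a ≟ punchIn a j) (punchInᵢ≢i a j ∘ sym))

count-partition : {A : Set} {R : Pred A 0ℓ} (R? : Decidable R) {k : ℕ} (g : A → Fin k) (xs : List A) →
                  ∑[ c < k ] count (λ x → R? x ×-dec (g x ≟ c)) xs ≡ count R? xs
count-partition R? {k} g []       = sum-replicate-zero k
count-partition {R = R} R? {k} g (x ∷ xs) = begin
  ∑[ c < k ] count (Rg? c) (x ∷ xs)
    ≡⟨ sum-cong-≗ (λ c → count-∷ (Rg? c) x xs) ⟩
  ∑[ c < k ] (indicator (Rg? c x) + count (Rg? c) xs)
    ≡⟨ ∑-distrib-+ (λ c → indicator (Rg? c x)) (λ c → count (Rg? c) xs) ⟩
  ∑[ c < k ] indicator (Rg? c x) + ∑[ c < k ] count (Rg? c) xs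
    ≡⟨ cong₂ _+_ (fibre (R? x)) (count-partition R? g xs) ⟩
  indicator (R? x) + count R? xs
    ≡⟨ count-∷ R? x xs ⟨
  count R? (x ∷ xs) ∎
  where
  Rg? : (c : Fin k) → Decidable (λ x → R x × g x ≡ c)
  Rg? c x = R? x ×-dec (g x ≟ c)
  fibre : {B : Set} (b? : Dec B) → ∑[ c < k ] indicator (b? ×-dec (g x ≟ c)) ≡ indicator b?
  fibre (yes _) = sum-delta (g x)
  fibre (no _)  = sum-replicate-zero k

Colouring : ℕ → ℕ → Set
Colouring N k = Fin N → Fin k

-- `Splits J`: every colouring of N points arises exactly once as J c f, for a colour c
-- and a colouring f of N′ points; hence counting any decidable property over all
-- colourings of N points is a sum over c of a count over colourings of N′ points.
Splits : ∀ {N N′ k} → (Fin k → Colouring N′ k → Colouring N k) → Set₁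
Splits {N} {N′} {k} J = ∀ {Q : Pred (Colouring N k) 0ℓ} (Q? : Decidable Q) →
  count Q? (allFns N k) ≡ ∑[ c < k ] count (λ f → Q? (J c f)) (allFns N′ k)

splits-cons : ∀ {N k} → Splits {suc N} {N} {k} VF._∷_
splits-cons {N} {k} Q? = begin
  count Q? (allFns (suc N) k)
    ≡⟨ count-concatMap Q? (λ c → c) (λ c → map (c VF.∷_) (allFns N k)) ⟩
  ∑[ c < k ] count Q? (map (c VF.∷_) (allFns N k))
    ≡⟨ sum-cong-≗ (λ c → count-map Q? (c VF.∷_) (allFns N k)) ⟩
  ∑[ c < k ] count (λ f → Q? (c VF.∷ f)) (allFns N k) ∎

splits-extend : ∀ {N N′ k} {J : Fin k → Colouring N′ k → Colouring N k} → Splits J →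
                Splits {suc N} {suc N′} (λ c f → f zero VF.∷ J c (VF.tail f))
splits-extend {N} {N′} {k} {J} J-splits Q? = begin
  count Q? (allFns (suc N) k)
    ≡⟨ splits-cons Q? ⟩
  ∑[ d < k ] count (λ g → Q? (d VF.∷ g)) (allFns N k)
    ≡⟨ sum-cong-≗ (λ d → J-splits (λ g → Q? (d VF.∷ g))) ⟩
  ∑[ d < k ] ∑[ c < k ] count (λ f → Q? (d VF.∷ J c f)) (allFns N′ k)
    ≡⟨ ∑-comm (λ d c → count (λ f → Q? (d VF.∷ J c f)) (allFns N′ k)) ⟩
  ∑[ c < k ] ∑[ d < k ] count (λ f → Q? (d VF.∷ J c f)) (allFns N′ k)
    ≡⟨ sum-cong-≗ (λ c → splits-cons (λ f → Q? (f zero VF.∷ J c (VF.tail f)))) ⟨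
  ∑[ c < k ] count (λ f → Q? (f zero VF.∷ J c (VF.tail f))) (allFns (suc N′) k) ∎

-- Insert the colour c at position a ↑ʳ i of a colouring, the positions being split into a
-- block of a and a block of b (respectively suc b) points.
insertAt : ∀ a {b k} → Fin (suc b) → Fin k → Colouring (a + b) k → Colouring (a + suc b) k
insertAt zero          zero    c f = c VF.∷ f
insertAt zero {suc b}  (suc i) c f = f zero VF.∷ insertAt zero i c (VF.tail f)
insertAt (suc a)       i       c f = f zero VF.∷ insertAt a i c (VF.tail f)

splits-insertAt : ∀ a {b k} (i : Fin (suc b)) → Splits {a + suc b} {a + b} {k} (insertAt a i)
splits-insertAt zero          zero    = splits-cons
splits-insertAt zero {suc b}  (suc i) = splits-extend (splits-insertAt zero i)
splits-insertAt (suc a)       i       = splits-extend (splits-insertAt a i)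

insertAt-new : ∀ a {b k} (i : Fin (suc b)) (c : Fin k) f → insertAt a i c f (a ↑ʳ i) ≡ c
insertAt-new zero          zero    c f = refl
insertAt-new zero {suc b}  (suc i) c f = insertAt-new zero i c (VF.tail f)
insertAt-new (suc a)       i       c f = insertAt-new a i c (VF.tail f)

insertAt-old : ∀ a {b k} (i : Fin (suc b)) (c : Fin k) f (j : Fin b) →
               insertAt a i c f (a ↑ʳ punchIn i j) ≡ f (a ↑ʳ j)
insertAt-old zero          zero    c f j       = refl
insertAt-old zero {suc b}  (suc i) c f zero    = refl
insertAt-old zero {suc b}  (suc i) c f (suc j) = insertAt-old zero i c (VF.tail f) j
insertAt-old (suc a)       i       c f j       = insertAt-old a i c (VF.tail f) j

insertAt-prefix : ∀ a {b k} (i : Fin (suc b)) (c : Fin k) f (x : Fin a) →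
                  insertAt a i c f (x ↑ˡ suc b) ≡ f (x ↑ˡ b)
insertAt-prefix (suc a) i c f zero    = refl
insertAt-prefix (suc a) i c f (suc x) = insertAt-prefix a i c (VF.tail f) x

punchIn-↑ˡ : ∀ {n} (i : Fin (suc n)) (j : Fin n) m → punchIn (i ↑ˡ m) (j ↑ˡ m) ≡ punchIn i j ↑ˡ m
punchIn-↑ˡ zero    j       m = refl
punchIn-↑ˡ (suc i) zero    m = refl
punchIn-↑ˡ (suc i) (suc j) m = cong suc (punchIn-↑ˡ i j m)

punchIn-↑ʳ : ∀ {n} (i : Fin (suc n)) m (f : Fin m) → punchIn (i ↑ˡ m) (n ↑ʳ f) ≡ suc n ↑ʳ f
punchIn-↑ʳ          zero    m f = refl
punchIn-↑ʳ {suc n}  (suc i) m f = cong suc (punchIn-↑ʳ i m f)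

Monochromatic : ∀ {k} → Fin k → Fin k → Fin k → Set
Monochromatic a b c = a ≡ c × b ≡ c

monochromatic? : ∀ {k} (a b c : Fin k) → Dec (Monochromatic a b c)
monochromatic? a b c = (a ≟ c) ×-dec (b ≟ c)

recolour : ∀ {k} {a a′ b b′ c c′ : Fin k} → a ≡ a′ → b ≡ b′ → c ≡ c′ →
           ¬ Monochromatic a b c → ¬ Monochromatic a′ b′ c′
recolour refl refl refl notMono = notMono

two-colours⇔ : ∀ {k} (a b c : Fin k) →
               1 < length (deduplicate _≟_ (a ∷ b ∷ c ∷ [])) ⇔ (¬ Monochromatic a b c)
two-colours⇔ a b c with b ≟ c
two-colours⇔ a b c | yes b≡c with a ≟ b
... | yes a≡b = mk⇔ (λ { (s≤s ()) }) (λ notMono → contradiction (trans a≡b b≡c , b≡c) notMono)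
... | no a≢b  = mk⇔ (λ _ (a≡c , b≡c′) → a≢b (trans a≡c (sym b≡c′))) (λ _ → s≤s (s≤s z≤n))
two-colours⇔ a b c | no b≢c with a ≟ b
... | yes a≡b with a ≟ c
...   | yes a≡c = contradiction (trans (sym a≡b) a≡c) b≢c
...   | no _    = mk⇔ (λ _ → b≢c ∘ proj₂) (λ _ → s≤s (s≤s z≤n))
two-colours⇔ a b c | no b≢c | no _ with a ≟ c
... | yes _ = mk⇔ (λ _ → b≢c ∘ proj₂) (λ _ → s≤s (s≤s z≤n))
... | no _  = mk⇔ (λ _ → b≢c ∘ proj₂) (λ _ → s≤s (s≤s z≤n))

NoMonochromaticEdge : ∀ {n m k} → (Fin m → Fin n × Fin n) → Colouring (n + m) k → Set
NoMonochromaticEdge {n} {m} ends φ =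
  ∀ f → ¬ Monochromatic (φ (proj₁ (ends f) ↑ˡ m)) (φ (proj₂ (ends f) ↑ˡ m)) (φ (n ↑ʳ f))

proper⇔ : ∀ {n m k} (ends : Fin m → Fin n × Fin n) (φ : Colouring (n + m) k) →
          Proper (H (mg n m ends)) k φ ⇔ NoMonochromaticEdge ends φ
proper⇔ ends φ = mk⇔
  (λ proper f → to (two-colours⇔ _ _ _) (tabulate⁻ (map⁻ proper) f))
  (λ noMono → map⁺ (tabulate⁺ (λ f → from (two-colours⇔ _ _ _) (noMono f))))

∀-punchIn : ∀ {m} {R : Fin (suc m) → Set} (e : Fin (suc m)) → R e → (∀ j → R (punchIn e j)) → ∀ f → R f
∀-punchIn {R = R} e Re Roff f with e ≟ f
... | yes refl = Re
... | no e≢f   = subst R (punchIn-punchOut e≢f) (Roff (punchOut e≢f))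

module Deletion {n m : ℕ} (ends : Fin (suc m) → Fin n × Fin n) (e : Fin (suc m)) (k : ℕ) where

  G G-e : Multigraph
  G   = mg n (suc m) ends
  G-e = deleteAux n m ends e

  u↑ v↑ : Fin (n + m)
  u↑ = proj₁ (ends e) ↑ˡ m
  v↑ = proj₂ (ends e) ↑ˡ m

  ProperIdentifying? : Decidable (λ ψ → Proper (H G-e) k ψ × ψ u↑ ≡ ψ v↑)
  ProperIdentifying? ψ = proper? (H G-e) k ψ ×-dec (ψ u↑ ≟ ψ v↑)

  module _ (c : Fin k) (ψ : Colouring (n + m) k) where

    -- ψ extended by the colour c at w_e.
    φ : Colouring (n + suc m) k
    φ = insertAt n e c ψ

    φ-at-v : ∀ x → φ (x ↑ˡ suc m) ≡ ψ (x ↑ˡ m)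
    φ-at-v = insertAt-prefix n e c ψ

    φ-at-w : ∀ j → φ (n ↑ʳ punchIn e j) ≡ ψ (n ↑ʳ j)
    φ-at-w = insertAt-old n e c ψ

    -- The hyperedges of H_G are those of H_{G-e}, coloured alike, plus {u, v, w_e}.
    extend-edges : NoMonochromaticEdge ends φ ⇔
                   (NoMonochromaticEdge (ends ∘ punchIn e) ψ × ¬ Monochromatic (ψ u↑) (ψ v↑) c)
    extend-edges = mk⇔
      (λ noMono → (λ j → recolour (φ-at-v _) (φ-at-v _) (φ-at-w j) (noMono (punchIn e j)))
                , recolour (φ-at-v _) (φ-at-v _) (insertAt-new n e c ψ) (noMono e))
      (λ (noMono , notMono) → ∀-punchIn e
         (recolour (sym (φ-at-v _)) (sym (φ-at-v _)) (sym (insertAt-new n e c ψ)) notMono)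
         (λ j → recolour (sym (φ-at-v _)) (sym (φ-at-v _)) (sym (φ-at-w j)) (noMono j)))

    extend-proper : Proper (H G) k φ ⇔ (Proper (H G-e) k ψ × ¬ Monochromatic (ψ u↑) (ψ v↑) c)
    extend-proper = mk⇔
      (λ proper → let (noMono , notMono) = to extend-edges (to (proper⇔ ends φ) proper) in
                  from (proper⇔ (ends ∘ punchIn e) ψ) noMono , notMono)
      (λ (proper , notMono) →
         from (proper⇔ ends φ) (from extend-edges (to (proper⇔ (ends ∘ punchIn e) ψ) proper , notMono)))

  deletion : P (H G) k + count ProperIdentifying? (allFns (n + m) k) ≡ k Nat.* P (H G-e) k
  deletion = begin
    P (H G) k + count ProperIdentifying? colourings
      ≡⟨ cong₂ _+_ P-by-colour-of-w (sym identifying-by-colour) ⟩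
    ∑[ c < k ] count (avoids c) colourings + ∑[ c < k ] count (meets c) colourings
      ≡⟨ ∑-distrib-+ (λ c → count (avoids c) colourings) (λ c → count (meets c) colourings) ⟨
    ∑[ c < k ] (count (avoids c) colourings + count (meets c) colourings)
      ≡⟨ sum-cong-≗ (λ c → count-split (proper? (H G-e) k) (λ ψ → monochromatic? (ψ u↑) (ψ v↑) c) colourings) ⟩
    ∑[ c < k ] P (H G-e) k
      ≡⟨ sum-const k (P (H G-e) k) ⟩
    k Nat.* P (H G-e) k ∎
    where
    colourings : List (Colouring (n + m) k)
    colourings = allFns (n + m) k
    avoids : (c : Fin k) → Decidable (λ ψ → Proper (H G-e) k ψ × ¬ Monochromatic (ψ u↑) (ψ v↑) c)
    meets  : (c : Fin k) → Decidable (λ ψ → Proper (H G-e) k ψ × Monochromatic (ψ u↑) (ψ v↑) c)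
    avoids c ψ = proper? (H G-e) k ψ ×-dec ¬? (monochromatic? (ψ u↑) (ψ v↑) c)
    meets  c ψ = proper? (H G-e) k ψ ×-dec monochromatic? (ψ u↑) (ψ v↑) c

    P-by-colour-of-w : P (H G) k ≡ ∑[ c < k ] count (avoids c) colourings
    P-by-colour-of-w = trans (splits-insertAt n e (proper? (H G) k))
      (sum-cong-≗ (λ c → count-⇔ _ (avoids c) (extend-proper c) colourings))

    identifying-by-colour : ∑[ c < k ] count (meets c) colourings ≡ count ProperIdentifying? colourings
    identifying-by-colour = trans
      (sum-cong-≗ (λ c → count-⇔ (meets c) (λ ψ → ProperIdentifying? ψ ×-dec (ψ u↑ ≟ c))
        (λ ψ → mk⇔ (λ (proper , u≡c , v≡c) → (proper , trans u≡c (sym v≡c)) , u≡c)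
                   (λ ((proper , u≡v) , u≡c) → proper , u≡c , trans (sym u≡v) u≡c))
        colourings))
      (count-partition ProperIdentifying? (λ ψ → ψ u↑) colourings)

-- `Merged v u x y`: y is the image of the vertex x when v is identified with u and the
-- vertices are renumbered by punching out v.
data Merged {n : ℕ} (v u : Fin (suc n)) : Fin (suc n) → Fin n → Set where
  at-v  : ∀ {x} → v ≡ x → (v≢u : v ≢ u) → Merged v u x (punchOut v≢u)
  off-v : ∀ {x} → (v≢x : v ≢ x) → Merged v u x (punchOut v≢x)

-- cends are the ends of the edges of G/e, for a non-loop e with ends u, v.
IsContraction : ∀ {n m} → (Fin (suc m) → Fin (suc n) × Fin (suc n)) → Fin (suc m) → (Fin m → Fin n × Fin n) → Set
IsContraction {n} ends e cends =
  ∀ f → Merged v u (proj₁ (ends (punchIn e f))) (proj₁ (cends f))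
      × Merged v u (proj₂ (ends (punchIn e f))) (proj₂ (cends f))
  where
  u v : Fin (suc n)
  u = proj₁ (ends e)
  v = proj₂ (ends e)

contract-loop : ∀ {n m} (ends : Fin (suc m) → Fin n × Fin n) e →
                proj₁ (ends e) ≡ proj₂ (ends e) → contractAux n m ends e ≡ deleteAux n m ends e
contract-loop ends e u≡v with proj₁ (ends e) ≟ proj₂ (ends e)
... | yes _   = refl
... | no u≢v  = contradiction u≡v u≢v

contract-nonloop : ∀ {n m} (ends : Fin (suc m) → Fin (suc n) × Fin (suc n)) e → proj₁ (ends e) ≢ proj₂ (ends e) →
                   Σ (Fin m → Fin n × Fin n) λ cends → contractAux (suc n) m ends e ≡ mg n m cends
contract-nonloop ends e u≢v with proj₁ (ends e) ≟ proj₂ (ends e)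
... | yes u≡v = contradiction u≡v u≢v
... | no _    = _ , refl

-- The edge ends of G/e are the merged images of those of G - e.  Matching the equation
-- against refl exposes the case analysis in the definition of the contraction, one edge
-- f at a time.
contract-endpoints : ∀ {n m} (ends : Fin (suc m) → Fin (suc n) × Fin (suc n)) e {cends : Fin m → Fin n × Fin n} →
                     proj₁ (ends e) ≢ proj₂ (ends e) → contractAux (suc n) m ends e ≡ mg n m cends →
                     IsContraction ends e cends
contract-endpoints ends e u≢v eq f with proj₁ (ends e) ≟ proj₂ (ends e)
... | yes u≡v = contradiction u≡v u≢v
contract-endpoints ends e _ refl f | no u≢v
  with proj₂ (ends e) ≟ proj₁ (ends (punchIn e f)) | proj₂ (ends e) ≟ proj₂ (ends (punchIn e f))
... | yes v≡x | yes v≡y = at-v v≡x (≢-sym u≢v) , at-v v≡y (≢-sym u≢v)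
... | yes v≡x | no v≢y  = at-v v≡x (≢-sym u≢v) , off-v v≢y
... | no v≢x  | yes v≡y = off-v v≢x            , at-v v≡y (≢-sym u≢v)
... | no v≢x  | no v≢y  = off-v v≢x            , off-v v≢y

-- For a non-loop e, colourings ψ of H_{G-e} with ψ u = ψ v correspond to proper colourings
-- χ of H_{G/e}: ψ is χ with the colour χ(u) inserted at v.
module Contraction {n m : ℕ} (ends : Fin (suc m) → Fin (suc n) × Fin (suc n)) (e : Fin (suc m)) (k : ℕ)
                   (u≢v : proj₁ (ends e) ≢ proj₂ (ends e))
                   {cends : Fin m → Fin n × Fin n} (isContraction : IsContraction ends e cends) where

  open Deletion ends e k using (G-e; u↑; v↑; ProperIdentifying?)

  u v : Fin (suc n)
  u = proj₁ (ends e)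
  v = proj₂ (ends e)

  v≢u : v ≢ u
  v≢u = ≢-sym u≢v

  uv : Fin (n + m)
  uv = punchOut v≢u ↑ˡ m

  lift : Fin k → Colouring (n + m) k → Colouring (suc n + m) k
  lift = insertAt 0 v↑

  module _ (c : Fin k) (χ : Colouring (n + m) k) where

    lift-off : ∀ {x} (v≢x : v ≢ x) → lift c χ (x ↑ˡ m) ≡ χ (punchOut v≢x ↑ˡ m)
    lift-off {x} v≢x = begin
      lift c χ (x ↑ˡ m)                                ≡⟨ cong (λ y → lift c χ (y ↑ˡ m)) (punchIn-punchOut v≢x) ⟨
      lift c χ (punchIn v (punchOut v≢x) ↑ˡ m)         ≡⟨ cong (lift c χ) (punchIn-↑ˡ v (punchOut v≢x) m) ⟨
      lift c χ (punchIn v↑ (punchOut v≢x ↑ˡ m))        ≡⟨ insertAt-old 0 v↑ c χ (punchOut v≢x ↑ˡ m) ⟩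
      χ (punchOut v≢x ↑ˡ m)                            ∎

    lift-w : ∀ f → lift c χ (suc n ↑ʳ f) ≡ χ (n ↑ʳ f)
    lift-w f = trans (cong (lift c χ) (sym (punchIn-↑ʳ v m f))) (insertAt-old 0 v↑ c χ (n ↑ʳ f))

    lift-merged : χ uv ≡ c → ∀ {x y} → Merged v u x y → lift c χ (x ↑ˡ m) ≡ χ (y ↑ˡ m)
    lift-merged uv≡c (at-v refl v≢u′) = begin
      lift c χ v↑              ≡⟨ insertAt-new 0 v↑ c χ ⟩
      c                        ≡⟨ uv≡c ⟨
      χ uv                     ≡⟨ cong (λ y → χ (y ↑ˡ m)) (punchOut-cong v refl) ⟩
      χ (punchOut v≢u′ ↑ˡ m)   ∎
    lift-merged uv≡c (off-v v≢x) = lift-off v≢x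

    lifted-edges : χ uv ≡ c → NoMonochromaticEdge (ends ∘ punchIn e) (lift c χ) ⇔ NoMonochromaticEdge cends χ
    lifted-edges uv≡c = mk⇔
      (λ noMono f → recolour (end₁ f) (end₂ f) (lift-w f) (noMono f))
      (λ noMono f → recolour (sym (end₁ f)) (sym (end₂ f)) (sym (lift-w f)) (noMono f))
      where
      end₁ : ∀ f → lift c χ (proj₁ (ends (punchIn e f)) ↑ˡ m) ≡ χ (proj₁ (cends f) ↑ˡ m)
      end₁ f = lift-merged uv≡c (proj₁ (isContraction f))
      end₂ : ∀ f → lift c χ (proj₂ (ends (punchIn e f)) ↑ˡ m) ≡ χ (proj₂ (cends f) ↑ˡ m)
      end₂ f = lift-merged uv≡c (proj₂ (isContraction f))

    lift-identifies⇔ : lift c χ u↑ ≡ lift c χ v↑ ⇔ χ uv ≡ c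
    lift-identifies⇔ = mk⇔ (λ u≡v → trans (sym (lift-off v≢u)) (trans u≡v (insertAt-new 0 v↑ c χ)))
                           (λ uv≡c → trans (lift-off v≢u) (trans uv≡c (sym (insertAt-new 0 v↑ c χ))))

    lift-proper : (Proper (H G-e) k (lift c χ) × lift c χ u↑ ≡ lift c χ v↑) ⇔
                  (Proper (H (mg n m cends)) k χ × χ uv ≡ c)
    lift-proper = mk⇔
      (λ (proper , u≡v) → let uv≡c = to lift-identifies⇔ u≡v in
         from (proper⇔ cends χ) (to (lifted-edges uv≡c) (to (proper⇔ (ends ∘ punchIn e) (lift c χ)) proper)) , uv≡c)
      (λ (proper , uv≡c) →
         from (proper⇔ (ends ∘ punchIn e) (lift c χ)) (from (lifted-edges uv≡c) (to (proper⇔ cends χ) proper))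
         , from lift-identifies⇔ uv≡c)

  contraction : count ProperIdentifying? (allFns (suc n + m) k) ≡ P (H (mg n m cends)) k
  contraction = begin
    count ProperIdentifying? (allFns (suc n + m) k)
      ≡⟨ splits-insertAt 0 v↑ ProperIdentifying? ⟩
    ∑[ c < k ] count (λ χ → ProperIdentifying? (lift c χ)) (allFns (n + m) k)
      ≡⟨ sum-cong-≗ (λ c → count-⇔ _ (λ χ → proper? (H (mg n m cends)) k χ ×-dec (χ uv ≟ c)) (lift-proper c)
                                     (allFns (n + m) k)) ⟩
    ∑[ c < k ] count (λ χ → proper? (H (mg n m cends)) k χ ×-dec (χ uv ≟ c)) (allFns (n + m) k)
      ≡⟨ count-partition (proper? (H (mg n m cends)) k) (λ χ → χ uv) (allFns (n + m) k) ⟩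
    P (H (mg n m cends)) k ∎

contraction-count : ∀ n m (ends : Fin (suc m) → Fin n × Fin n) e k →
  count (Deletion.ProperIdentifying? ends e k) (allFns (n + m) k) ≡ P (H (contractAux n m ends e)) k
contraction-count zero    m ends e k = ⊥-elim (¬Fin0 (proj₁ (ends e)))
contraction-count (suc n) m ends e k = [ loop , nonloop ]′ (toSum (proj₁ (ends e) ≟ proj₂ (ends e)))
  where
  open Deletion ends e k using (G-e; ProperIdentifying?)

  -- For a loop, ψ u = ψ v always holds and G/e = G - e.
  loop : proj₁ (ends e) ≡ proj₂ (ends e) →
         count ProperIdentifying? (allFns (suc n + m) k) ≡ P (H (contractAux (suc n) m ends e)) k
  loop u≡v = begin
    count ProperIdentifying? (allFns (suc n + m) k)
      ≡⟨ count-⇔ ProperIdentifying? (proper? (H G-e) k)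
                 (λ ψ → mk⇔ proj₁ (λ proper → proper , cong (λ x → ψ (x ↑ˡ m)) u≡v))
                 (allFns (suc n + m) k) ⟩
    P (H G-e) k
      ≡⟨ cong (λ G′ → P (H G′) k) (contract-loop ends e u≡v) ⟨
    P (H (contractAux (suc n) m ends e)) k ∎

  nonloop : proj₁ (ends e) ≢ proj₂ (ends e) →
            count ProperIdentifying? (allFns (suc n + m) k) ≡ P (H (contractAux (suc n) m ends e)) k
  nonloop u≢v with contract-nonloop ends e u≢v
  ... | cends , G/e≡ = trans (Contraction.contraction ends e k u≢v (contract-endpoints ends e u≢v G/e≡))
                             (cong (λ G′ → P (H G′) k) (sym G/e≡))

+-sub : ∀ {a b c : ℕ} → a + c ≡ b → + a ≡ + b - + c
+-sub {a} {c = c} refl = sym (begin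
  + (a + c) - + c    ≡⟨ m-n≡m⊖n (a + c) c ⟩
  (a + c) ⊖ c        ≡⟨ ⊖-≥ (m≤n+m c a) ⟩
  + ((a + c) ∸ c)    ≡⟨ cong +_ (m+n∸n≡m a c) ⟩
  + a                ∎)

proposition5 : (G : Multigraph) (e : Fin (nE G)) (λ′ : ℕ) → 1 ≤ λ′ →
    + P (H G) λ′ ≡ (+ λ′) * (+ P (H (delete G e)) λ′) - + P (H (contract G e)) λ′
proposition5 (mg n zero    ends) () k _
proposition5 (mg n (suc m) ends) e  k _ = begin
  + P (H G) k
    ≡⟨ +-sub deletion ⟩
  + (k Nat.* P (H G-e) k) - + count ProperIdentifying? (allFns (n + m) k)
    ≡⟨ cong₂ _-_ (pos-* k (P (H G-e) k)) (cong +_ (contraction-count n m ends e k)) ⟩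
  + k * + P (H G-e) k - + P (H (contractAux n m ends e)) k ∎
  where open Deletion ends e k
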